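{- Let $\Lambda$ be an integral representation of the cyclic group $C_n$ (a lattice with a $\mathbb{Z}$-linear $C_n$-action) with a full-rank subrepresentation $\Lambda'\subseteq\Lambda$, and let $F$ be a generator of $C_n$, $D=F-1$. Suppose $\Lambda'$ is the permutation representation of an action of $C_n$ on a finite set whose orbits have sizes $m_1,\dots,m_k$. Then $\mathcal{T}_D(\Lambda')\cong\prod_{i}C_{m_i}$ and $\mathfrak{B}_{\Lambda,\Lambda'}$ is trivial.
   Context: $V=\Lambda\otimes\mathbb{Q}$, $V[D]=\ker D$ (so $V=DV\oplus V[D]$ since the action is semisimple). $\mathcal{T}_D(\Lambda')=\Lambda'/\big((\Lambda'\cap DV)+(\Lambda'\cap V[D])\big)$ and $\mathfrak{B}_{\Lambda,\Lambda'}=\dfrac{\Lambda+D^{ -1}\Lambda'}{\Lambda+V[D]}$ with $D^{ -1}\Lambda'=\{v\in V:Dv\in\Lambda'\}$. -}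

module Defs where

open import Data.Nat as ℕ using (ℕ; zero; suc; _≟_)
open import Data.Nat.Properties using (suc-injective)
open import Data.Fin using (Fin; zero; suc; toℕ; lower₁)
open import Data.Integer as ℤ using (ℤ)
open import Data.Integer.Divisibility using () renaming (_∣_ to _∣ℤ_)
open import Data.Rational as ℚ using (ℚ)
open import Data.Product using (Σ; ∃; _×_)
open import Relation.Binary.PropositionalEquality using (_≡_; refl; sym)
open import Relation.Nullary using (yes; no)

-- The generator of C_n acts on Fin m by the m-cycle j ↦ j+1 (mod m).
cyc : ∀ {m} → Fin m → Fin m
cyc {suc m} j with toℕ j ≟ m
... | yes _ = zero
... | no ne = lower₁ (suc j) (λ eq → ne (sym (suc-injective eq)))

-- The finite C_n-set with orbits of sizes m 0, …, m (k-1):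
-- the disjoint union of cycles of length m i.
Pts : (k : ℕ) → (Fin k → ℕ) → Set
Pts k m = Σ (Fin k) (λ i → Fin (m i))

σ : ∀ {k} {m : Fin k → ℕ} → Pts k m → Pts k m
σ (i Data.Product., j) = i Data.Product., cyc j

-- V = Λ' ⊗ ℚ = ℚ^X, with X = Pts k m.
V : (k : ℕ) → (Fin k → ℕ) → Set
V k m = Pts k m → ℚ

-- Permutation action of the generator F on V (F e_x = e_{σ⁻¹ x}),
-- and D = F - 1.
Fop : ∀ {k m} → V k m → V k m
Fop v x = v (σ x)

Dop : ∀ {k m} → V k m → V k m
Dop v x = Fop v x ℚ.- v x

ι : ℤ → ℚ
ι z = z ℚ./ 1

InΛ' : ∀ {k m} → V k m → Set
InΛ' v = ∀ x → ∃ λ (z : ℤ) → v x ≡ ι z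

InDV : ∀ {k m} → V k m → Set
InDV {k} {m} u = ∃ λ (v : V k m) → ∀ x → Dop v x ≡ u x

InKerD : ∀ {k m} → V k m → Set
InKerD v = ∀ x → Dop v x ≡ ℚ.0ℚ

sumℚ : ∀ {s} → (Fin s → ℚ) → ℚ
sumℚ {zero} f = ℚ.0ℚ
sumℚ {suc s} f = f zero ℚ.+ sumℚ (λ j → f (suc j))

InSpan : ∀ {k m s} → (Fin s → V k m) → V k m → Set
InSpan {s = s} g v = ∃ λ (c : Fin s → ℤ) → ∀ x → v x ≡ sumℚ (λ j → ι (c j) ℚ.* g j x)

toV : ∀ {k m} → (Pts k m → ℤ) → V k m
toV a x = ι (a x)

-- The relation defining T_D(Λ') = Λ' / ((Λ' ∩ DV) + (Λ' ∩ V[D])):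
-- a ~ b iff a - b = u + w with u ∈ Λ' ∩ DV, w ∈ Λ' ∩ V[D].
T-rel : ∀ {k m} → (Pts k m → ℤ) → (Pts k m → ℤ) → Set
T-rel {k} {m} a b =
  ∃ λ (u : Pts k m → ℤ) → ∃ λ (w : Pts k m → ℤ) →
    (∀ x → a x ℤ.- b x ≡ u x ℤ.+ w x) × InDV (toV u) × InKerD (toV w)

-- Elements of ∏_i C_{m i}, represented by Fin k → ℤ modulo m i in slot i.
ProdRel : ∀ {k} → (Fin k → ℕ) → (Fin k → ℤ) → (Fin k → ℤ) → Set
ProdRel m s t = ∀ i → (ℤ.+ m i) ∣ℤ (s i ℤ.- t i)

-- An isomorphism of groups T_D(Λ') ≅ ∏_i C_{m i}, given as a map on
-- representatives that is additive, surjective, and whose fibres are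
-- exactly the T_D-classes (i.e. it induces a bijective homomorphism
-- on the quotient).
T≅Prod : (k : ℕ) (m : Fin k → ℕ) → Set
T≅Prod k m =
  ∃ λ (φ : (Pts k m → ℤ) → (Fin k → ℤ)) →
    (∀ a b → ProdRel m (φ (λ x → a x ℤ.+ b x)) (λ i → φ a i ℤ.+ φ b i))
    × (∀ a b → T-rel a b → ProdRel m (φ a) (φ b))
    × (∀ a b → ProdRel m (φ a) (φ b) → T-rel a b)
    × (∀ t → ∃ λ a → ProdRel m (φ a) t)

-- 𝔅_{Λ,Λ'} = (Λ + D⁻¹Λ') / (Λ + V[D]) is trivial: every element of
-- Λ + D⁻¹Λ' lies in Λ + V[D].
BTrivial : ∀ {k m} → (V k m → Set) → Set
BTrivial {k} {m} InΛ =
  ∀ (l v : V k m) → InΛ l → InΛ' (Dop v) →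
    ∃ λ (l' : V k m) → ∃ λ (w : V k m) →
      InΛ l' × InKerD w × (∀ x → l x ℚ.+ v x ≡ l' x ℚ.+ w x)

{-# OPTIONS --safe #-}
module Submission where

-- On an orbit of length m the
-- differences Δ f = f ∘ cyc − f have coordinate sum 0, every vector of coordinate sum 0
-- is Δ of its partial sums, and ker Δ consists of the constants. Hence an integer vector
-- lies in (Λ' ∩ DV) + (Λ' ∩ V[D]) iff each orbit sum is divisible by the orbit length,
-- so the orbit sums induce T_D(Λ') ≅ ∏ C_{m_i}. If Dv is integral then v is constant
-- modulo ℤ along each orbit, so v ∈ Λ' + V[D] ⊆ Λ + V[D] and 𝔅 is trivial.

open import Algebra.Bundles using (AbelianGroup)
import Algebra.Properties.AbelianGroup as AbelianGroupProperties
import Algebra.Properties.CommutativeMonoid.Sum as CommutativeMonoidSum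
open import Data.Fin using (Fin; zero; suc; toℕ; inject₁; fromℕ)
open import Data.Fin.Induction using (<-weakInduction)
open import Data.Fin.Properties using (toℕ-fromℕ; toℕ-inject₁-≢; lower₁-inject₁′)
open import Data.Fin.Relation.Unary.Top using (view; ‵fromℕ; ‵inject₁)
open import Data.Integer as ℤ using (ℤ; +_)
import Data.Integer.Properties as ℤP
open import Data.Integer.Divisibility using () renaming (_∣_ to _∣ℤ_)
open import Data.Integer.Divisibility.Signed as Signed using (divides; ∣⇒∣ᵤ; ∣ᵤ⇒∣)
open import Data.Nat using (ℕ; zero; suc; NonZero; _≟_)
open import Data.Nat.Divisibility using (_∣_; _∣0)
open import Data.Nat.Properties using (suc-injective)
open import Data.Product using (∃; _×_; _,_; proj₁; proj₂)
open import Data.Rational as ℚ using (ℚ)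
import Data.Rational.Properties as ℚP
open import Data.Rational.Unnormalised as ℚᵘ using (mkℚᵘ; *≡*)
import Data.Rational.Unnormalised.Properties as ℚᵘP
open import Function using (_∘_)
open import Relation.Binary.Core using (Rel)
open import Relation.Binary.Definitions using (Reflexive; Transitive)
open import Relation.Binary.PropositionalEquality as ≡ using (_≡_)
open import Relation.Nullary using (yes; no; contradiction)

open import Algebra.Properties.CommutativeSemigroup (AbelianGroup.commutativeSemigroup ℚP.+-0-abelianGroup)
  using (x∙yz≈xz∙y)

open import Defs

cyc-fromℕ : ∀ n → cyc (fromℕ n) ≡ zero
cyc-fromℕ n with toℕ (fromℕ n) ≟ n
... | yes _   = ≡.refl
... | no n≢n = contradiction (toℕ-fromℕ n) n≢n

cyc-inject₁ : ∀ {n} (j : Fin n) → cyc (inject₁ j) ≡ suc j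
cyc-inject₁ {n} j with toℕ (inject₁ j) ≟ n
... | yes j≡n = contradiction (≡.sym j≡n) (toℕ-inject₁-≢ j)
... | no j≢n  = lower₁-inject₁′ (suc j) (λ eq → j≢n (≡.sym (suc-injective eq)))

cyc-connected : ∀ {a ℓ} {A : Set a} {_∼_ : Rel A ℓ} → Reflexive _∼_ → Transitive _∼_ →
                ∀ {n} (f : Fin (suc n) → A) → (∀ j → f j ∼ f (cyc j)) → ∀ j → f zero ∼ f j
cyc-connected {_∼_ = _∼_} ∼-refl ∼-trans f step = <-weakInduction (λ j → f zero ∼ f j) ∼-refl extend
  where
  extend : ∀ i → f zero ∼ f (inject₁ i) → f zero ∼ f (suc i)
  extend i 0∼i = ∼-trans 0∼i (≡.subst (λ j → f (inject₁ i) ∼ f j) (cyc-inject₁ i) (step (inject₁ i)))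

module CyclicSums {a ℓ} (G : AbelianGroup a ℓ) where

  open AbelianGroup G
  open AbelianGroupProperties G using (//-rightDividesˡ; identityˡ-unique; inverseʳ-unique; xyx⁻¹≈y; x≈z//y)
  open CommutativeMonoidSum commutativeMonoid public using (sum; sum-cong-≋; ∑-distrib-+; sum-replicate-zero)
  open CommutativeMonoidSum commutativeMonoid using (sum-init-last)
  open import Relation.Binary.Reasoning.Setoid setoid

  Δ : ∀ {n} → (Fin n → Carrier) → Fin n → Carrier
  Δ f j = f (cyc j) - f j

  sum-∘cyc : ∀ {n} (f : Fin n → Carrier) → sum (f ∘ cyc) ≈ sum f
  sum-∘cyc {zero}  f = refl
  sum-∘cyc {suc n} f = begin
    sum (f ∘ cyc)                              ≈⟨ sum-init-last (f ∘ cyc) ⟩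
    sum (f ∘ cyc ∘ inject₁) ∙ f (cyc (fromℕ n)) ≈⟨ ∙-cong (sum-cong-≋ (reflexive ∘ ≡.cong f ∘ cyc-inject₁))
                                                          (reflexive (≡.cong f (cyc-fromℕ n))) ⟩
    sum (f ∘ suc) ∙ f zero                      ≈⟨ comm _ _ ⟩
    sum f                                       ∎

  sum-Δ : ∀ {n} (f : Fin n → Carrier) → sum (Δ f) ≈ ε
  sum-Δ f = identityˡ-unique (sum (Δ f)) (sum f) (begin
    sum (Δ f) ∙ sum f          ≈⟨ ∑-distrib-+ (Δ f) f ⟨
    sum (λ j → Δ f j ∙ f j)    ≈⟨ sum-cong-≋ (λ j → //-rightDividesˡ (f j) (f (cyc j))) ⟩
    sum (f ∘ cyc)              ≈⟨ sum-∘cyc f ⟩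
    sum f                      ∎)

  sum-- : ∀ {n} (f g : Fin n → Carrier) → sum (λ j → f j - g j) ≈ sum f - sum g
  sum-- f g = x≈z//y _ (sum g) (sum f) (begin
    sum (λ j → f j - g j) ∙ sum g   ≈⟨ ∑-distrib-+ (λ j → f j - g j) g ⟨
    sum (λ j → (f j - g j) ∙ g j)   ≈⟨ sum-cong-≋ (λ j → //-rightDividesˡ (g j) (f j)) ⟩
    sum f                           ∎)

  partialSum : ∀ {n} → (Fin n → Carrier) → Fin n → Carrier
  partialSum f zero    = ε
  partialSum f (suc j) = f zero ∙ partialSum (f ∘ suc) j

  partialSum-suc : ∀ {n} (f : Fin (suc n) → Carrier) (j : Fin n) →
                   partialSum f (suc j) ≈ partialSum f (inject₁ j) ∙ f (inject₁ j)
  partialSum-suc f zero    = comm (f zero) ε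
  partialSum-suc f (suc j) = trans (∙-congˡ (partialSum-suc (f ∘ suc) j)) (sym (assoc _ _ _))

  partialSum-fromℕ : ∀ {n} (f : Fin (suc n) → Carrier) → partialSum f (fromℕ n) ∙ f (fromℕ n) ≈ sum f
  partialSum-fromℕ {zero}  f = comm ε (f zero)
  partialSum-fromℕ {suc n} f = trans (assoc _ _ _) (∙-congˡ (partialSum-fromℕ (f ∘ suc)))

  Δ-partialSum : ∀ {n} (f : Fin n → Carrier) → sum f ≈ ε → ∀ j → Δ (partialSum f) j ≈ f j
  Δ-partialSum {suc n} f Σf≈ε j with view j
  ... | ‵fromℕ = begin
    partialSum f (cyc (fromℕ n)) - partialSum f (fromℕ n) ≡⟨ ≡.cong (λ i → partialSum f i - partialSum f (fromℕ n)) (cyc-fromℕ n) ⟩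
    ε - partialSum f (fromℕ n)                            ≈⟨ identityˡ _ ⟩
    partialSum f (fromℕ n) ⁻¹                             ≈⟨ inverseʳ-unique _ _ (trans (partialSum-fromℕ f) Σf≈ε) ⟨
    f (fromℕ n)                                           ∎
  ... | ‵inject₁ i = begin
    partialSum f (cyc (inject₁ i)) - partialSum f (inject₁ i)          ≡⟨ ≡.cong (λ i′ → partialSum f i′ - partialSum f (inject₁ i)) (cyc-inject₁ i) ⟩
    partialSum f (suc i) - partialSum f (inject₁ i)                    ≈⟨ ∙-congʳ (partialSum-suc f i) ⟩
    partialSum f (inject₁ i) ∙ f (inject₁ i) - partialSum f (inject₁ i) ≈⟨ xyx⁻¹≈y _ _ ⟩
    f (inject₁ i)                                                      ∎

module ℤΣ = CyclicSums ℤP.+-0-abelianGroup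
module ℚΣ = CyclicSums ℚP.+-0-abelianGroup
module ℤG = AbelianGroupProperties ℤP.+-0-abelianGroup
module ℚG = AbelianGroupProperties ℚP.+-0-abelianGroup

ι-toℚᵘ : ∀ z → ℚ.toℚᵘ (ι z) ℚᵘ.≃ mkℚᵘ z 0
ι-toℚᵘ z = ℚP.toℚᵘ-fromℚᵘ (mkℚᵘ z 0)

ι-+ : ∀ a b → ι (a ℤ.+ b) ≡ ι a ℚ.+ ι b
ι-+ a b = ℚP.toℚᵘ-injective (begin
  ℚ.toℚᵘ (ι (a ℤ.+ b))            ≈⟨ ι-toℚᵘ (a ℤ.+ b) ⟩
  mkℚᵘ (a ℤ.+ b) 0                ≈⟨ *≡* (≡.cong (ℤ._* + 1) (≡.cong₂ ℤ._+_ (≡.sym (ℤP.*-identityʳ a)) (≡.sym (ℤP.*-identityʳ b)))) ⟩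
  mkℚᵘ a 0 ℚᵘ.+ mkℚᵘ b 0          ≈⟨ ℚᵘP.+-cong (ι-toℚᵘ a) (ι-toℚᵘ b) ⟨
  ℚ.toℚᵘ (ι a) ℚᵘ.+ ℚ.toℚᵘ (ι b)  ≈⟨ ℚP.toℚᵘ-homo-+ (ι a) (ι b) ⟨
  ℚ.toℚᵘ (ι a ℚ.+ ι b)            ∎)
  where open ℚᵘP.≃-Reasoning

ι-injective : ∀ {a b} → ι a ≡ ι b → a ≡ b
ι-injective {a} {b} ιa≡ιb with ℚᵘP.≃-trans (ℚᵘP.≃-sym (ι-toℚᵘ a)) (ℚᵘP.≃-trans (ℚP.toℚᵘ-cong ιa≡ιb) (ι-toℚᵘ b))
... | *≡* a*1≡b*1 = ≡.trans (≡.sym (ℤP.*-identityʳ a)) (≡.trans a*1≡b*1 (ℤP.*-identityʳ b))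

ι-sum : ∀ {n} (f : Fin n → ℤ) → ι (ℤΣ.sum f) ≡ ℚΣ.sum (ι ∘ f)
ι-sum {zero}  f = ≡.refl
ι-sum {suc n} f = ≡.trans (ι-+ (f zero) _) (≡.cong (ι (f zero) ℚ.+_) (ι-sum (f ∘ suc)))

sum-const : ∀ n c → ℤΣ.sum {n} (λ _ → c) ≡ c ℤ.* + n
sum-const zero    c = ≡.sym (ℤP.*-zeroʳ c)
sum-const (suc n) c = ≡.trans (≡.cong (ℤ._+_ c) (sum-const n c)) (≡.sym (ℤP.*-suc c (+ n)))

cyc-invariant⇒∣sum : ∀ {n} (f : Fin n → ℤ) → (∀ j → f (cyc j) ≡ f j) → + n ∣ℤ ℤΣ.sum f
cyc-invariant⇒∣sum {zero}  f _ = 0 ∣0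
cyc-invariant⇒∣sum {suc n} f f∘cyc≡f = ∣⇒∣ᵤ (divides (f zero) (≡.trans Σf≡Σf₀ (sum-const (suc n) (f zero))))
  where
  Σf≡Σf₀ : ℤΣ.sum f ≡ ℤΣ.sum {suc n} (λ _ → f zero)
  Σf≡Σf₀ = ℤΣ.sum-cong-≋ (λ j → ≡.sym (cyc-connected {_∼_ = _≡_} ≡.refl ≡.trans f (≡.sym ∘ f∘cyc≡f) j))

sum-surjective : ∀ n → NonZero n → (c : ℤ) → ∃ λ (f : Fin n → ℤ) → ℤΣ.sum f ≡ c
sum-surjective (suc n) _ c = point , ≡.trans (≡.cong (ℤ._+_ c) (ℤΣ.sum-replicate-zero n)) (ℤP.+-identityʳ c)
  where
  point : Fin (suc n) → ℤ
  point zero    = c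
  point (suc _) = + 0

module _ {k : ℕ} {m : Fin k → ℕ} where

  orbitSum : (Pts k m → ℤ) → Fin k → ℤ
  orbitSum a i = ℤΣ.sum (λ j → a (i , j))

  orbitSum-+ : ∀ a b i → orbitSum (λ x → a x ℤ.+ b x) i ≡ orbitSum a i ℤ.+ orbitSum b i
  orbitSum-+ a b i = ℤΣ.∑-distrib-+ (λ j → a (i , j)) (λ j → b (i , j))

  orbitSum-- : ∀ a b i → orbitSum (λ x → a x ℤ.- b x) i ≡ orbitSum a i ℤ.- orbitSum b i
  orbitSum-- a b i = ℤΣ.sum-- (λ j → a (i , j)) (λ j → b (i , j))

  -- Dop v (i , j) is definitionally ℚΣ.Δ (λ j → v (i , j)) j.
  InDV-toV⇒orbitSum≡0 : ∀ {u : Pts k m → ℤ} → InDV (toV u) → ∀ i → orbitSum u i ≡ + 0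
  InDV-toV⇒orbitSum≡0 {u} (v , Dv≡u) i = ι-injective (begin
    ι (orbitSum u i)                ≡⟨ ι-sum (λ j → u (i , j)) ⟩
    ℚΣ.sum (λ j → ι (u (i , j)))    ≡⟨ ℚΣ.sum-cong-≋ (λ j → ≡.sym (Dv≡u (i , j))) ⟩
    ℚΣ.sum (ℚΣ.Δ (λ j → v (i , j))) ≡⟨ ℚΣ.sum-Δ (λ j → v (i , j)) ⟩
    ℚ.0ℚ                            ∎)
    where open ≡.≡-Reasoning

  orbitSum≡0⇒InDV-toV : ∀ {u : Pts k m → ℤ} → (∀ i → orbitSum u i ≡ + 0) → InDV (toV u)
  orbitSum≡0⇒InDV-toV {u} Σu≡0 =
    (λ (i , j) → ℚΣ.partialSum (ιu i) j) , λ (i , j) → ℚΣ.Δ-partialSum (ιu i) (Σιu≡0 i) j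
    where
    ιu : ∀ i → Fin (m i) → ℚ
    ιu i j = ι (u (i , j))
    Σιu≡0 : ∀ i → ℚΣ.sum (ιu i) ≡ ℚ.0ℚ
    Σιu≡0 i = ≡.trans (≡.sym (ι-sum (λ j → u (i , j)))) (≡.cong ι (Σu≡0 i))

  InKerD-toV⇒cyc-invariant : ∀ {w : Pts k m → ℤ} → InKerD (toV w) → ∀ i j → w (i , cyc j) ≡ w (i , j)
  InKerD-toV⇒cyc-invariant {w} Dw≡0 i j =
    ι-injective (ℚG.x∙y⁻¹≈ε⇒x≈y (ι (w (i , cyc j))) (ι (w (i , j))) (Dw≡0 (i , j)))

  ≡⇒ProdRel : ∀ {s t} → (∀ i → s i ≡ t i) → ProdRel m s t
  ≡⇒ProdRel s≡t i = ≡.subst (+ m i ∣ℤ_) (≡.sym (ℤG.x≈y⇒x∙y⁻¹≈ε (s≡t i))) (m i ∣0)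

  T-rel⇒ProdRel : ∀ a b → T-rel a b → ProdRel m (orbitSum a) (orbitSum b)
  T-rel⇒ProdRel a b (u , w , a-b≡u+w , u∈DV , w∈kerD) i =
    ≡.subst (+ m i ∣ℤ_) (≡.sym Σa-Σb≡Σw)
      (cyc-invariant⇒∣sum (λ j → w (i , j)) (InKerD-toV⇒cyc-invariant {w} w∈kerD i))
    where
    open ≡.≡-Reasoning
    Σa-Σb≡Σw : orbitSum a i ℤ.- orbitSum b i ≡ orbitSum w i
    Σa-Σb≡Σw = begin
      orbitSum a i ℤ.- orbitSum b i         ≡⟨ orbitSum-- a b i ⟨
      orbitSum (λ x → a x ℤ.- b x) i        ≡⟨ ℤΣ.sum-cong-≋ (λ j → a-b≡u+w (i , j)) ⟩
      orbitSum (λ x → u x ℤ.+ w x) i        ≡⟨ orbitSum-+ u w i ⟩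
      orbitSum u i ℤ.+ orbitSum w i         ≡⟨ ≡.cong (ℤ._+ orbitSum w i) (InDV-toV⇒orbitSum≡0 {u} u∈DV i) ⟩
      + 0 ℤ.+ orbitSum w i                  ≡⟨ ℤP.+-identityˡ (orbitSum w i) ⟩
      orbitSum w i                          ∎

  ProdRel⇒T-rel : ∀ a b → ProdRel m (orbitSum a) (orbitSum b) → T-rel a b
  ProdRel⇒T-rel a b m∣Σa-Σb =
    u , w , (λ x → ≡.sym (ℤG.//-rightDividesˡ (w x) (a x ℤ.- b x))) , u∈DV , w∈kerD
    where
    open ≡.≡-Reasoning
    m∣Σa-Σbˢ : ∀ i → + m i Signed.∣ orbitSum a i ℤ.- orbitSum b i
    m∣Σa-Σbˢ i = ∣ᵤ⇒∣ (m∣Σa-Σb i)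
    q : Fin k → ℤ
    q i = Signed._∣_.quotient (m∣Σa-Σbˢ i)
    w u : Pts k m → ℤ
    w (i , _) = q i
    u x = (a x ℤ.- b x) ℤ.- w x
    w∈kerD : InKerD (toV w)
    w∈kerD x = ℚP.+-inverseʳ (toV w x)
    u∈DV : InDV (toV u)
    u∈DV = orbitSum≡0⇒InDV-toV λ i → begin
      orbitSum u i                                    ≡⟨ orbitSum-- (λ x → a x ℤ.- b x) w i ⟩
      orbitSum (λ x → a x ℤ.- b x) i ℤ.- orbitSum w i ≡⟨ ≡.cong₂ ℤ._-_ (orbitSum-- a b i) (sum-const (m i) (q i)) ⟩
      (orbitSum a i ℤ.- orbitSum b i) ℤ.- q i ℤ.* + m i ≡⟨ ≡.cong (ℤ._- q i ℤ.* + m i) (Signed._∣_.equality (m∣Σa-Σbˢ i)) ⟩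
      q i ℤ.* + m i ℤ.- q i ℤ.* + m i                 ≡⟨ ℤP.+-inverseʳ (q i ℤ.* + m i) ⟩
      + 0                                             ∎

  orbitSum-surjective : (∀ i → NonZero (m i)) → (t : Fin k → ℤ) → ∃ λ (a : Pts k m → ℤ) → ∀ i → orbitSum a i ≡ t i
  orbitSum-surjective nz t = (λ (i , j) → proj₁ (orbit i) j) , proj₂ ∘ orbit
    where
    orbit : ∀ i → ∃ λ (f : Fin (m i) → ℤ) → ℤΣ.sum f ≡ t i
    orbit i = sum-surjective (m i) (nz i) (t i)

  orbitSum-T≅Prod : (∀ i → NonZero (m i)) → T≅Prod k m
  orbitSum-T≅Prod nz =
    orbitSum , (λ a b → ≡⇒ProdRel (orbitSum-+ a b)) , T-rel⇒ProdRel , ProdRel⇒T-rel , surjective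
    where
    surjective : (t : Fin k → ℤ) → ∃ λ (a : Pts k m → ℤ) → ProdRel m (orbitSum a) t
    surjective t with orbitSum-surjective nz t
    ... | a , Σa≡t = a , ≡⇒ProdRel Σa≡t

record _~ℤ_ (p q : ℚ) : Set where
  constructor _,_
  field
    offset   : ℤ
    ≡+offset : q ≡ p ℚ.+ ι offset
open _~ℤ_

~ℤ-refl : Reflexive _~ℤ_
~ℤ-refl {p} = + 0 , ≡.sym (ℚP.+-identityʳ p)

~ℤ-trans : Transitive _~ℤ_
~ℤ-trans {p} {q} {r} (y , q≡p+y) (z , r≡q+z) = y ℤ.+ z , (begin
  r                       ≡⟨ r≡q+z ⟩
  q ℚ.+ ι z               ≡⟨ ≡.cong (ℚ._+ ι z) q≡p+y ⟩
  p ℚ.+ ι y ℚ.+ ι z       ≡⟨ ℚP.+-assoc p (ι y) (ι z) ⟩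
  p ℚ.+ (ι y ℚ.+ ι z)     ≡⟨ ≡.cong (p ℚ.+_) (ι-+ y z) ⟨
  p ℚ.+ ι (y ℤ.+ z)       ∎)
  where open ≡.≡-Reasoning

integral-Δ⇒~ℤ-const : ∀ {n} (f : Fin n → ℚ) → (∀ j → ∃ λ z → ℚΣ.Δ f j ≡ ι z) → ∃ λ c → ∀ j → c ~ℤ f j
integral-Δ⇒~ℤ-const {zero}  f _      = ℚ.0ℚ , λ ()
integral-Δ⇒~ℤ-const {suc n} f Δf∈ℤ = f zero , cyc-connected {_∼_ = _~ℤ_} ~ℤ-refl ~ℤ-trans f step
  where
  step : ∀ j → f j ~ℤ f (cyc j)
  step j with Δf∈ℤ j
  ... | z , Δfj≡z = z , (begin
    f (cyc j)                   ≡⟨ ℚG.//-rightDividesˡ (f j) (f (cyc j)) ⟨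
    ℚΣ.Δ f j ℚ.+ f j            ≡⟨ ≡.cong (ℚ._+ f j) Δfj≡z ⟩
    ι z ℚ.+ f j                 ≡⟨ ℚP.+-comm (ι z) (f j) ⟩
    f j ℚ.+ ι z                 ∎)
    where open ≡.≡-Reasoning

sumℚ≡sum : ∀ {s} (f : Fin s → ℚ) → sumℚ f ≡ ℚΣ.sum f
sumℚ≡sum {zero}  f = ≡.refl
sumℚ≡sum {suc s} f = ≡.cong (f zero ℚ.+_) (sumℚ≡sum (f ∘ suc))

InSpan-+ : ∀ {k m s} {g : Fin s → V k m} {u v : V k m} →
           InSpan g u → InSpan g v → InSpan g (λ x → u x ℚ.+ v x)
InSpan-+ {g = g} {u} {v} (c , u≡Σcg) (d , v≡Σdg) = (λ j → c j ℤ.+ d j) , λ x → begin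
  u x ℚ.+ v x                                             ≡⟨ ≡.cong₂ ℚ._+_ (u≡Σcg x) (v≡Σdg x) ⟩
  sumℚ (λ j → ι (c j) ℚ.* g j x) ℚ.+ sumℚ (λ j → ι (d j) ℚ.* g j x)
      ≡⟨ ≡.cong₂ ℚ._+_ (sumℚ≡sum (λ j → ι (c j) ℚ.* g j x)) (sumℚ≡sum (λ j → ι (d j) ℚ.* g j x)) ⟩
  ℚΣ.sum (λ j → ι (c j) ℚ.* g j x) ℚ.+ ℚΣ.sum (λ j → ι (d j) ℚ.* g j x)
      ≡⟨ ℚΣ.∑-distrib-+ (λ j → ι (c j) ℚ.* g j x) (λ j → ι (d j) ℚ.* g j x) ⟨
  ℚΣ.sum (λ j → ι (c j) ℚ.* g j x ℚ.+ ι (d j) ℚ.* g j x)  ≡⟨ ℚΣ.sum-cong-≋ (λ j → distrib j x) ⟨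
  ℚΣ.sum (λ j → ι (c j ℤ.+ d j) ℚ.* g j x)                ≡⟨ sumℚ≡sum (λ j → ι (c j ℤ.+ d j) ℚ.* g j x) ⟨
  sumℚ (λ j → ι (c j ℤ.+ d j) ℚ.* g j x)                  ∎
  where
  open ≡.≡-Reasoning
  distrib : ∀ j x → ι (c j ℤ.+ d j) ℚ.* g j x ≡ ι (c j) ℚ.* g j x ℚ.+ ι (d j) ℚ.* g j x
  distrib j x = ≡.trans (≡.cong (ℚ._* g j x) (ι-+ (c j) (d j))) (ℚP.*-distribʳ-+ (g j x) (ι (c j)) (ι (d j)))

Λ'⊆span⇒BTrivial : ∀ {k m s} (g : Fin s → V k m) → (∀ a → InSpan g (toV a)) → BTrivial (InSpan g)
Λ'⊆span⇒BTrivial {k} {m} g Λ'⊆Λ l v l∈Λ Dv∈Λ' =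
  l′ , w , InSpan-+ {g = g} l∈Λ (Λ'⊆Λ a) , w∈kerD , l+v≡l′+w
  where
  base : ∀ i → ∃ λ c → ∀ j → c ~ℤ v (i , j)
  base i = integral-Δ⇒~ℤ-const (λ j → v (i , j)) (λ j → Dv∈Λ' (i , j))
  w : V k m
  w (i , _) = proj₁ (base i)
  a : Pts k m → ℤ
  a (i , j) = offset (proj₂ (base i) j)
  l′ : V k m
  l′ x = l x ℚ.+ toV a x
  w∈kerD : InKerD w
  w∈kerD x = ℚP.+-inverseʳ (w x)
  l+v≡l′+w : ∀ x → l x ℚ.+ v x ≡ l′ x ℚ.+ w x
  l+v≡l′+w x@(i , j) =
    ≡.trans (≡.cong (l x ℚ.+_) (≡+offset (proj₂ (base i) j))) (x∙yz≈xz∙y (l x) (w x) (ι (a x)))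

lemma2p5p1 : (n k : ℕ) (m : Fin k → ℕ)
    → (∀ i → NonZero (m i)) → (∀ i → m i ∣ n)
    → (s : ℕ) (g : Fin s → V k m)
    → (∀ (a : Pts k m → ℤ) → InSpan g (toV a))
    → (∀ j → InSpan g (Fop (g j)))
    → T≅Prod k m × BTrivial (InSpan g)
lemma2p5p1 n k m nz _ s g Λ'⊆Λ _ = orbitSum-T≅Prod nz , Λ'⊆span⇒BTrivial g Λ'⊆Λ
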